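{- Let $t\in\mathbb{N}$ and let $G$ be a graph in $\mathcal{X}_t$ with no cut vertices. Then the vertex set of any maximal induced complete bipartite subgraph $K_{p,q}$ of $G$ with $p,q\ge 3t^2+t+1$ is a module of $G$.
   Context: All graphs are finite and simple. For graphs $G_1=(V_1,E_1)$, $G_2=(V_2,E_2)$, $G_1\cap G_2=(V_1\cap V_2,E_1\cap E_2)$. For $G=(V,E)$ and an injective map $\alpha$ on $V$, $G^{\alpha}$ has vertex set $\alpha(V)$ and edge set $\{\{\alpha(v),\alpha(w)\}:\{v,w\}\in E\}$. We write $G\xrightarrow{\cap}H$ if $H=G^{\alpha_1}\cap\cdots\cap G^{\alpha_k}$ for some injective maps $\alpha_1,\dots,\alpha_k$ on $V(G)$ (up to isomorphism of $H$). $S_{t,t,t}$ is obtained from $K_{1,3}$ by subdividing each edge with $t-1$ new vertices; $tS_{t,t,t}$ is the disjoint union of $t$ copies of $S_{t,t,t}$; $\mathcal{X}_t$ is the class of graphs $G$ with $G\not\xrightarrow{\cap}tS_{t,t,t}$. A cut vertex is a vertex $v$ with $G-v$ disconnected. A set $U\subseteq V(G)$ is a module if every vertex outside $U$ is either adjacent to all or to none of the vertices of $U$. "Maximal induced complete bipartite subgraph" means an induced subgraph that is complete bipartite (with nonempty parts) and is not properly contained in a larger induced complete bipartite subgraph. -}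

module Defs where

open import Data.Nat using (ℕ; zero; suc; _+_; _*_; _≤_)
open import Data.Fin using (Fin; toℕ)
open import Data.Fin.Subset using (Subset; _∈_; _∉_; _∪_; ∣_∣)
open import Data.Bool using (Bool; true; false)
open import Data.Maybe using (Maybe; just; nothing)
open import Data.Product using (Σ; ∃; _×_; _,_)
open import Data.Sum using (_⊎_)
open import Relation.Nullary using (¬_)
open import Relation.Binary.PropositionalEquality using (_≡_; _≢_)
open import Function.Definitions using (Injective)

record Graph : Set where
  field
    n     : ℕ
    adj   : Fin n → Fin n → Bool
    sym   : ∀ u v → adj u v ≡ adj v u
    irrefl : ∀ v → adj v v ≡ false

open Graph public

Edge : (G : Graph) → Fin (n G) → Fin (n G) → Set
Edge G u v = adj G u v ≡ true

-- G ─∩→ H, where H is given by a vertex type V and an adjacency relation AdjH: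
-- there are k ≥ 1 injective maps α₁,…,αₖ of V(G) (into the universe ℕ) such that
-- H is isomorphic (via φ) to G^{α₁} ∩ ⋯ ∩ G^{αₖ}.
IntersectsTo : (G : Graph) (V : Set) (AdjH : V → V → Set) → Set
IntersectsTo G V AdjH =
  Σ ℕ λ k →
  Σ (Fin (suc k) → Fin (n G) → ℕ) λ α →
    (∀ i → Injective _≡_ _≡_ (α i)) ×
  Σ (V → ℕ) λ φ →
    Injective _≡_ _≡_ φ ×
    (∀ a i → ∃ λ v → α i v ≡ φ a) ×
    (∀ x → (∀ i → ∃ λ v → α i v ≡ x) → ∃ λ a → φ a ≡ x) ×
    (∀ a b → AdjH a b →
       ∀ i → Σ (Fin (n G)) λ v → Σ (Fin (n G)) λ w →
               α i v ≡ φ a × α i w ≡ φ b × Edge G v w) ×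
    (∀ a b → (∀ i → Σ (Fin (n G)) λ v → Σ (Fin (n G)) λ w →
               α i v ≡ φ a × α i w ≡ φ b × Edge G v w) → AdjH a b)

-- t S_{t,t,t}: vertices (copy c, nothing) = centre of copy c,
-- (copy c, just (j , i)) = the (i+1)-th vertex (from the centre) on leg j of copy c.
tSttt-V : ℕ → Set
tSttt-V t = Fin t × Maybe (Fin 3 × Fin t)

data tSttt-Adj (t : ℕ) : tSttt-V t → tSttt-V t → Set where
  centre-leg : ∀ c j (i : Fin t) → toℕ i ≡ 0 →
               tSttt-Adj t (c , nothing) (c , just (j , i))
  leg-centre : ∀ c j (i : Fin t) → toℕ i ≡ 0 →
               tSttt-Adj t (c , just (j , i)) (c , nothing)
  leg-next   : ∀ c j (i i' : Fin t) → suc (toℕ i) ≡ toℕ i' →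
               tSttt-Adj t (c , just (j , i)) (c , just (j , i'))
  leg-prev   : ∀ c j (i i' : Fin t) → suc (toℕ i) ≡ toℕ i' →
               tSttt-Adj t (c , just (j , i')) (c , just (j , i))

InX : ℕ → Graph → Set
InX t G = ¬ IntersectsTo G (tSttt-V t) (tSttt-Adj t)

data WalkAvoiding (G : Graph) (x : Fin (n G)) : Fin (n G) → Fin (n G) → Set where
  here : ∀ {a} → WalkAvoiding G x a a
  step : ∀ {a b c} → Edge G a b → b ≢ x → WalkAvoiding G x b c → WalkAvoiding G x a c

CutVertex : (G : Graph) → Fin (n G) → Set
CutVertex G x = Σ (Fin (n G)) λ a → Σ (Fin (n G)) λ b →
  a ≢ x × b ≢ x × ¬ WalkAvoiding G x a b

IsModule : (G : Graph) → Subset (n G) → Set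
IsModule G U = ∀ x → x ∉ U →
  (∀ u → u ∈ U → Edge G x u) ⊎ (∀ u → u ∈ U → ¬ Edge G x u)

InducedCompleteBipartite : (G : Graph) → Subset (n G) → Subset (n G) → Set
InducedCompleteBipartite G A B =
  (∃ λ a → a ∈ A) × (∃ λ b → b ∈ B) ×
  (∀ v → v ∈ A → v ∈ B → Data.Empty.⊥) ×
  (∀ u v → u ∈ A → v ∈ A → ¬ Edge G u v) ×
  (∀ u v → u ∈ B → v ∈ B → ¬ Edge G u v) ×
  (∀ u v → u ∈ A → v ∈ B → Edge G u v)
  where import Data.Empty

-- Not properly contained in a larger induced complete bipartite subgraph
-- (induced subgraphs are determined by their vertex sets).
MaximalInducedCompleteBipartite : (G : Graph) → Subset (n G) → Subset (n G) → Set
MaximalInducedCompleteBipartite G A B =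
  InducedCompleteBipartite G A B ×
  (∀ A' B' → InducedCompleteBipartite G A' B' →
     (∀ v → v ∈ (A ∪ B) → v ∈ (A' ∪ B')) →
     (∀ v → v ∈ (A' ∪ B') → v ∈ (A ∪ B)))

-- Let x ∉ A ∪ B have a neighbour and a non-neighbour in A ∪ B; we build copies of t S_{t,t,t} in G
-- whose intersection is t S_{t,t,t}, contradicting G ∈ 𝒳_t. By maximality of the biclique, x sees
-- some u but not some w on the same side, and as u is not a cut vertex, x reaches A ∪ B again at
-- some z ∉ {u, w} along a path whose interior avoids A ∪ B. Both sides have at least
-- |V(t S_{t,t,t})| = t (3t + 1) vertices, so the forest t S_{t,t,t} embeds into the biclique along
-- any of its 2-colourings; these embeddings separate every non-adjacent pair except those at odd
-- distance in one spider. Such a pair is separated by sending one of them, a leg vertex s, to x,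
-- its neighbour towards the centre to u, the other one to w, and the leg beyond s along the path
-- to z and then to and fro across the biclique.

module Submission where

open import Defs hiding (sym; irrefl)
open import Data.Nat using (ℕ; zero; suc; _+_; _*_; _∸_; _≤_; _<_; s≤s)
import Data.Nat.Properties as ℕ
open import Data.Nat.Tactic.RingSolver using (solve-∀)
open import Data.Fin using (Fin; toℕ; zero; suc; combine; remQuot; inject≤; inject₁)
import Data.Fin.Properties as Fin
open import Data.Fin.Subset using (Subset; _∈_; _∉_; _∪_; ⁅_⁆; ∣_∣)
open import Data.Fin.Subset.Properties using (_∈?_; x∈p∪q⁺; x∈p∪q⁻; x∈⁅x⁆; x∈⁅y⁆⇒x≡y)
open import Data.Vec using (_∷_; here; there)
open import Data.Bool using (Bool; true; false; not; _xor_)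
import Data.Bool.Properties as Bool
open import Data.Maybe using (Maybe; just; nothing)
open import Data.Product using (Σ; ∃; _×_; _,_; proj₁; proj₂)
import Data.Sum
open import Data.Sum using (_⊎_; inj₁; inj₂; [_,_]′)
open import Data.Empty using (⊥; ⊥-elim)
open import Data.List using (List; []; _∷_; length)
open import Data.List.Relation.Unary.Any using (here; there; any?)
open import Data.List.Relation.Unary.All as All using (All; []; _∷_)
open import Data.List.Relation.Unary.All.Properties using (¬Any⇒All¬; All¬⇒¬Any)
open import Data.List.Relation.Unary.Unique.Propositional using (Unique; []; _∷_)
open import Data.List.Membership.Propositional renaming (_∈_ to _∈ₗ_; _∉_ to _∉ₗ_)
open import Function using (_∘_)
open import Function.Definitions using (Injective)
open import Relation.Nullary using (¬_; Dec; yes; no)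
open import Relation.Nullary.Decidable using (_×-dec_; _→-dec_; ¬?; decidable-stable)
open import Relation.Unary using (Decidable)
import Relation.Binary as B
open import Relation.Binary using (tri<; tri≈; tri>)
open import Relation.Binary.PropositionalEquality

edge-sym : ∀ (G : Graph) {u v} → Edge G u v → Edge G v u
edge-sym G {u} {v} uv = trans (Graph.sym G v u) uv

edge-irreflexive : ∀ (G : Graph) {u v} → Edge G u v → u ≢ v
edge-irreflexive G {u} uu refl with trans (sym uu) (Graph.irrefl G u)
... | ()

edge? : ∀ (G : Graph) u v → Dec (Edge G u v)
edge? G u v = adj G u v Bool.≟ true

complete⊎anticomplete⊎splits : ∀ (G : Graph) (U : Subset (n G)) x →
  ((∀ u → u ∈ U → Edge G x u) ⊎ (∀ u → u ∈ U → ¬ Edge G x u)) ⊎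
  ((∃ λ u → u ∈ U × Edge G x u) × (∃ λ w → w ∈ U × ¬ Edge G x w))
complete⊎anticomplete⊎splits G U x with Fin.all? (λ u → u ∈? U →-dec edge? G x u)
... | yes complete = inj₁ (inj₁ λ u → complete u)
... | no ¬complete with Fin.all? (λ u → u ∈? U →-dec ¬? (edge? G x u))
...   | yes anticomplete = inj₁ (inj₂ λ u → anticomplete u)
...   | no ¬anticomplete = inj₂ (neighbour , non-neighbour)
  where
  neighbour : ∃ λ u → u ∈ U × Edge G x u
  neighbour with Fin.any? (λ u → u ∈? U ×-dec edge? G x u)
  ... | yes found = found
  ... | no none = ⊥-elim (¬anticomplete λ u u∈U xu → none (u , u∈U , xu))
  non-neighbour : ∃ λ w → w ∈ U × ¬ Edge G x w
  non-neighbour with Fin.any? (λ w → w ∈? U ×-dec ¬? (edge? G x w))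
  ... | yes found = found
  ... | no none = ⊥-elim (¬complete λ w w∈U → decidable-stable (edge? G x w) λ ¬xw → none (w , w∈U , ¬xw))

icb-swap : ∀ {G A B} → InducedCompleteBipartite G A B → InducedCompleteBipartite G B A
icb-swap {G} (a , b , disjoint , A-independent , B-independent , complete) =
  b , a , (λ v v∈B v∈A → disjoint v v∈A v∈B) , B-independent , A-independent ,
  λ u v u∈B v∈A → edge-sym G (complete v u v∈A u∈B)

icb-extend : ∀ {G A B} x → InducedCompleteBipartite G A B → x ∉ A → (∀ a → a ∈ A → Edge G x a) →
  (∀ b → b ∈ B → ¬ Edge G x b) → InducedCompleteBipartite G A (B ∪ ⁅ x ⁆)
icb-extend {G} {A} {B} x (a , _ , disjoint , A-independent , B-independent , complete) x∉A x-A ¬x-B =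
  a , (x , x∈p∪q⁺ (inj₂ (x∈⁅x⁆ x))) , disjoint′ , A-independent , independent′ , complete′
  where
  B∪x⁻ : ∀ {v} → v ∈ B ∪ ⁅ x ⁆ → v ∈ B ⊎ v ≡ x
  B∪x⁻ v∈ = Data.Sum.map₂ (x∈⁅y⁆⇒x≡y x) (x∈p∪q⁻ B ⁅ x ⁆ v∈)
  disjoint′ : ∀ v → v ∈ A → v ∈ B ∪ ⁅ x ⁆ → ⊥
  disjoint′ v v∈A v∈ with B∪x⁻ v∈
  ... | inj₁ v∈B = disjoint v v∈A v∈B
  ... | inj₂ refl = x∉A v∈A
  independent′ : ∀ u v → u ∈ B ∪ ⁅ x ⁆ → v ∈ B ∪ ⁅ x ⁆ → ¬ Edge G u v
  independent′ u v u∈ v∈ with B∪x⁻ u∈ | B∪x⁻ v∈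
  ... | inj₁ u∈B | inj₁ v∈B = B-independent u v u∈B v∈B
  ... | inj₂ refl | inj₁ v∈B = ¬x-B v v∈B
  ... | inj₁ u∈B | inj₂ refl = ¬x-B u u∈B ∘ edge-sym G
  ... | inj₂ refl | inj₂ refl = λ xx → edge-irreflexive G xx refl
  complete′ : ∀ u v → u ∈ A → v ∈ B ∪ ⁅ x ⁆ → Edge G u v
  complete′ u v u∈A v∈ with B∪x⁻ v∈
  ... | inj₁ v∈B = complete u v u∈A v∈B
  ... | inj₂ refl = edge-sym G (x-A u u∈A)

-- Injections between finite sets

elementOf : ∀ {N} (p : Subset N) → Fin ∣ p ∣ → Fin N
elementOf (true ∷ p) zero = zero
elementOf (true ∷ p) (suc q) = suc (elementOf p q)
elementOf (false ∷ p) q = suc (elementOf p q)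

elementOf-∈ : ∀ {N} (p : Subset N) q → elementOf p q ∈ p
elementOf-∈ (true ∷ p) zero = here
elementOf-∈ (true ∷ p) (suc q) = there (elementOf-∈ p q)
elementOf-∈ (false ∷ p) q = there (elementOf-∈ p q)

elementOf-injective : ∀ {N} (p : Subset N) → Injective _≡_ _≡_ (elementOf p)
elementOf-injective (true ∷ p) {zero} {zero} _ = refl
elementOf-injective (true ∷ p) {suc q} {suc q'} eq = cong suc (elementOf-injective p (Fin.suc-injective eq))
elementOf-injective (false ∷ p) eq = elementOf-injective p (Fin.suc-injective eq)

-- Puts e at p; the position that held e, if any, receives h p instead, so injectivity is kept.
overwrite : ∀ {m N} → (Fin m → Fin N) → Fin m → Fin N → Fin m → Fin N
overwrite h p e q with q Fin.≟ p | h q Fin.≟ e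
... | yes _ | _ = e
... | no _ | yes _ = h p
... | no _ | no _ = h q

overwrite-at : ∀ {m N} (h : Fin m → Fin N) p e → overwrite h p e p ≡ e
overwrite-at h p e with p Fin.≟ p
... | yes _ = refl
... | no p≢p = ⊥-elim (p≢p refl)

overwrite-elsewhere : ∀ {m N} (h : Fin m → Fin N) {p e q} → q ≢ p → h q ≢ e → overwrite h p e q ≡ h q
overwrite-elsewhere h {p} {e} {q} q≢p hq≢e with q Fin.≟ p | h q Fin.≟ e
... | yes q≡p | _ = ⊥-elim (q≢p q≡p)
... | no _ | yes hq≡e = ⊥-elim (hq≢e hq≡e)
... | no _ | no _ = refl

overwrite-∈ : ∀ {m N} (h : Fin m → Fin N) {p e} (S : Subset N) → (∀ q → h q ∈ S) → e ∈ S →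
  ∀ q → overwrite h p e q ∈ S
overwrite-∈ h {p} {e} S h∈S e∈S q with q Fin.≟ p | h q Fin.≟ e
... | yes _ | _ = e∈S
... | no _ | yes _ = h∈S p
... | no _ | no _ = h∈S q

overwrite-injective : ∀ {m N} (h : Fin m → Fin N) {p e} → Injective _≡_ _≡_ h →
  Injective _≡_ _≡_ (overwrite h p e)
overwrite-injective h {p} {e} h-inj {q} {q'} eq with q Fin.≟ p | h q Fin.≟ e | q' Fin.≟ p | h q' Fin.≟ e
... | yes q≡p | _ | yes q'≡p | _ = trans q≡p (sym q'≡p)
... | yes _ | _ | no q'≢p | yes hq'≡e = ⊥-elim (q'≢p (h-inj (trans hq'≡e eq)))
... | yes _ | _ | no _ | no hq'≢e = ⊥-elim (hq'≢e (sym eq))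
... | no q≢p | yes hq≡e | yes _ | _ = ⊥-elim (q≢p (h-inj (trans hq≡e (sym eq))))
... | no _ | no hq≢e | yes _ | _ = ⊥-elim (hq≢e eq)
... | no _ | yes hq≡e | no _ | yes hq'≡e = h-inj (trans hq≡e (sym hq'≡e))
... | no _ | yes _ | no q'≢p | no _ = ⊥-elim (q'≢p (sym (h-inj eq)))
... | no q≢p | no _ | no _ | yes _ = ⊥-elim (q≢p (h-inj eq))
... | no _ | no _ | no _ | no _ = h-inj eq

injective-avoids-two : ∀ {m N} (g : Fin m → Fin N) → Injective _≡_ _≡_ g → 2 < m →
  ∀ u z → ∃ λ p → g p ≢ u × g p ≢ z
injective-avoids-two g g-injective 2<m u z with Fin.any? (λ p → ¬? (g p Fin.≟ u) ×-dec ¬? (g p Fin.≟ z))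
... | yes avoiding = avoiding
... | no ¬avoiding =
  let i , j , i<j , same = Fin.pigeonhole 2<m (λ p → isU (g p Fin.≟ u))
  in ⊥-elim (Fin.<⇒≢ i<j (g-injective (collide (g i Fin.≟ u) (g j Fin.≟ u) same)))
  where
  isU : ∀ {p} → Dec (g p ≡ u) → Fin 2
  isU (yes _) = zero
  isU (no _) = suc zero
  is-z : ∀ {p} → g p ≢ u → g p ≡ z
  is-z {p} gp≢u = decidable-stable (g p Fin.≟ z) λ gp≢z → ¬avoiding (p , gp≢u , gp≢z)
  collide : ∀ {i j} (di : Dec (g i ≡ u)) (dj : Dec (g j ≡ u)) → isU di ≡ isU dj → g i ≡ g j
  collide (yes gi≡u) (yes gj≡u) _ = trans gi≡u (sym gj≡u)
  collide (no gi≢u) (no gj≢u) _ = trans (is-z gi≢u) (sym (is-z gj≢u))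

-- Intersections of embedded copies

Searchable : Set → Set₁
Searchable A = {P : A → Set} → Decidable P → Dec (∃ P)

search-× : ∀ {A B} → Searchable A → Searchable B → Searchable (A × B)
search-× searchA searchB P? with searchA (λ a → searchB (λ b → P? (a , b)))
... | yes (a , b , p) = yes ((a , b) , p)
... | no ¬p = no λ { ((a , b) , p) → ¬p (a , b , p) }

search-Maybe : ∀ {A} → Searchable A → Searchable (Maybe A)
search-Maybe searchA P? with P? nothing | searchA (λ a → P? (just a))
... | yes p | _ = yes (nothing , p)
... | no _ | yes (a , p) = yes (just a , p)
... | no ¬n | no ¬j = no λ { (nothing , p) → ¬n p ; (just a , p) → ¬j (a , p) }

record Embedding (G : Graph) {V : Set} (Adj : V → V → Set) : Set where
  field
    map       : V → Fin (n G)
    injective : Injective _≡_ _≡_ map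
    adjacent  : ∀ {a b} → Adj a b → Edge G (map a) (map b)
open Embedding

Separating : (G : Graph) {V : Set} (Adj : V → V → Set) → V → V → Set
Separating G Adj a b = Σ (Embedding G Adj) λ E → ¬ Edge G (map E a) (map E b)

-- A vertex of G outside the image of the i-th embedding gets a private label m + ⟨i , v⟩,
-- so two copies of the same embedding already cut the intersection down to the image.
module _ {V : Set} {Adj : V → V → Set} (adj? : B.Decidable Adj) (search : Searchable V)
         {m : ℕ} (code : V → Fin m) (code-injective : Injective _≡_ _≡_ code) (G : Graph)
         (E₀ : Embedding G Adj) (separate : ∀ a b → ¬ Adj a b → Separating G Adj a b) where

  private
    separator : ∀ p q → Dec (∃ λ a → code a ≡ p) → Dec (∃ λ b → code b ≡ q) → Embedding G Adj
    separator _ _ (yes (a , _)) (yes (b , _)) with adj? a b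
    ... | yes _ = E₀
    ... | no ¬ab = proj₁ (separate a b ¬ab)
    separator _ _ _ _ = E₀

    separator-separates : ∀ a b → ¬ Adj a b →
      (da : Dec (∃ λ a' → code a' ≡ code a)) (db : Dec (∃ λ b' → code b' ≡ code b)) →
      ¬ Edge G (map (separator _ _ da db) a) (map (separator _ _ da db) b)
    separator-separates a b ¬ab (yes (a' , ea)) (yes (b' , eb))
      with code-injective ea | code-injective eb
    ... | refl | refl with adj? a b
    ...   | yes ab = ⊥-elim (¬ab ab)
    ...   | no ¬ab' = proj₂ (separate a b ¬ab')
    separator-separates a _ _ (no ¬a) _ = ⊥-elim (¬a (a , refl))
    separator-separates _ b _ (yes _) (no ¬b) = ⊥-elim (¬b (b , refl))

    pairEmbedding : Fin m → Fin m → Embedding G Adj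
    pairEmbedding p q = separator p q (search λ a → code a Fin.≟ p) (search λ b → code b Fin.≟ q)

    k : ℕ
    k = suc (m * m)

    E : Fin (suc k) → Embedding G Adj
    E zero = E₀
    E (suc zero) = E₀
    E (suc (suc pq)) = let (p , q) = remQuot m pq in pairEmbedding p q

    E-separates : ∀ a b → ¬ Adj a b → Σ (Fin (suc k)) λ i → ¬ Edge G (map (E i) a) (map (E i) b)
    E-separates a b ¬ab = suc (suc (combine (code a) (code b))) ,
      subst (λ (pq : Fin m × Fin m) → let (p , q) = pq in ¬ Edge G (map (pairEmbedding p q) a) (map (pairEmbedding p q) b))
        (sym (Fin.remQuot-combine (code a) (code b)))
        (separator-separates a b ¬ab (search λ a' → code a' Fin.≟ code a) (search λ b' → code b' Fin.≟ code b))

    φ : V → ℕ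
    φ a = toℕ (code a)

    label : ∀ i v → Dec (∃ λ a → map (E i) a ≡ v) → ℕ
    label _ _ (yes (a , _)) = φ a
    label i v (no _) = m + toℕ (combine i v)

    α : Fin (suc k) → Fin (n G) → ℕ
    α i v = label i v (search λ a → map (E i) a Fin.≟ v)

    φ<m : ∀ a → φ a < m
    φ<m a = Fin.toℕ<n (code a)

    private-label≢φ : ∀ (i : Fin (suc k)) (v : Fin (n G)) a → m + toℕ (combine i v) ≢ φ a
    private-label≢φ i v a eq = ℕ.<⇒≢ (ℕ.<-≤-trans (φ<m a) (ℕ.m≤m+n m (toℕ (combine i v)))) (sym eq)

    α-image : ∀ i a → α i (map (E i) a) ≡ φ a
    α-image i a with search (λ a' → map (E i) a' Fin.≟ map (E i) a)
    ... | yes (a' , e) = cong φ (injective (E i) e)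
    ... | no ¬a = ⊥-elim (¬a (a , refl))

    α≡φ⇒image : ∀ i v a → α i v ≡ φ a → v ≡ map (E i) a
    α≡φ⇒image i v a eq with search (λ a' → map (E i) a' Fin.≟ v)
    ... | yes (a' , e) = trans (sym e) (cong (map (E i)) (code-injective (Fin.toℕ-injective eq)))
    ... | no _ = ⊥-elim (private-label≢φ i v a eq)

    α-injective : ∀ i → Injective _≡_ _≡_ (α i)
    α-injective i {v} {w} eq with search (λ a → map (E i) a Fin.≟ v) | search (λ a → map (E i) a Fin.≟ w)
    ... | yes (a , ea) | yes (b , eb) =
      trans (sym ea) (trans (cong (map (E i)) (code-injective (Fin.toℕ-injective eq))) eb)
    ... | yes (a , _) | no _ = ⊥-elim (private-label≢φ i w a (sym eq))
    ... | no _ | yes (b , _) = ⊥-elim (private-label≢φ i v b eq)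
    ... | no _ | no _ = Fin.combine-injectiveʳ i v i w (Fin.toℕ-injective (ℕ.+-cancelˡ-≡ m _ _ eq))

    α-image-or-private : ∀ i v → (∃ λ a → α i v ≡ φ a) ⊎ α i v ≡ m + toℕ (combine i v)
    α-image-or-private i v with search (λ a → map (E i) a Fin.≟ v)
    ... | yes (a , _) = inj₁ (a , refl)
    ... | no _ = inj₂ refl

    covered : ∀ x → (∀ i → ∃ λ v → α i v ≡ x) → ∃ λ a → φ a ≡ x
    covered x hit with hit zero | hit (suc zero)
    ... | v₀ , e₀ | v₁ , e₁ with α-image-or-private zero v₀ | α-image-or-private (suc zero) v₁
    ... | inj₁ (a , e) | _ = a , trans (sym e) e₀
    ... | inj₂ _ | inj₁ (a , e) = a , trans (sym e) e₁
    ... | inj₂ p | inj₂ q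
      with Fin.combine-injectiveˡ {suc k} zero v₀ (suc zero) v₁
             (Fin.toℕ-injective (ℕ.+-cancelˡ-≡ m _ _ (trans (sym p) (trans e₀ (trans (sym e₁) q)))))
    ...   | ()

    edge-in-every-copy⇒Adj : ∀ a b → (∀ i → Σ (Fin (n G)) λ v → Σ (Fin (n G)) λ w →
                               α i v ≡ φ a × α i w ≡ φ b × Edge G v w) → Adj a b
    edge-in-every-copy⇒Adj a b every with adj? a b
    ... | yes ab = ab
    ... | no ¬ab with E-separates a b ¬ab
    ... | i , ¬edge with every i
    ... | v , w , ea , eb , vw = ⊥-elim (¬edge (subst₂ (Edge G) (α≡φ⇒image i v a ea) (α≡φ⇒image i w b eb) vw))

  intersectsTo-of-separating : IntersectsTo G V Adj
  intersectsTo-of-separating = k , α , α-injective , φ , (λ eq → code-injective (Fin.toℕ-injective eq)) ,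
    (λ a i → map (E i) a , α-image i a) ,
    covered ,
    (λ a b ab i → map (E i) a , map (E i) b , α-image i a , α-image i b , adjacent (E i) ab) ,
    edge-in-every-copy⇒Adj

-- Embeddings into a complete bipartite subgraph

ProperColouring : {V : Set} (Adj : V → V → Set) → (V → Bool) → Set
ProperColouring Adj col = ∀ {a b} → Adj a b → col b ≡ not (col a)

module CompleteBipartite (G : Graph) {A B : Subset (n G)} (K : InducedCompleteBipartite G A B) where

  private
    N : ℕ
    N = n G

  side : Bool → Subset N
  side true = A
  side false = B

  side⊆U : ∀ b {v} → v ∈ side b → v ∈ A ∪ B
  side⊆U true v∈A = x∈p∪q⁺ (inj₁ v∈A)
  side⊆U false v∈B = x∈p∪q⁺ (inj₂ v∈B)

  U⊆sides : ∀ {v} → v ∈ A ∪ B → Σ Bool λ b → v ∈ side b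
  U⊆sides {v} v∈U with x∈p∪q⁻ A B v∈U
  ... | inj₁ v∈A = true , v∈A
  ... | inj₂ v∈B = false , v∈B

  side-independent : ∀ b {u v} → u ∈ side b → v ∈ side b → ¬ Edge G u v
  side-independent true = proj₁ (proj₂ (proj₂ (proj₂ K))) _ _
  side-independent false = proj₁ (proj₂ (proj₂ (proj₂ (proj₂ K)))) _ _

  side-complete : ∀ b {u v} → u ∈ side b → v ∈ side (not b) → Edge G u v
  side-complete true = proj₂ (proj₂ (proj₂ (proj₂ (proj₂ K)))) _ _
  side-complete false u∈B v∈A = edge-sym G (proj₂ (proj₂ (proj₂ (proj₂ (proj₂ K)))) _ _ v∈A u∈B)

  sides-disjoint : ∀ b {u} → u ∈ side b → u ∉ side (not b)
  sides-disjoint true = proj₁ (proj₂ (proj₂ K)) _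
  sides-disjoint false u∈B u∈A = proj₁ (proj₂ (proj₂ K)) _ u∈A u∈B

  record Slots (m : ℕ) : Set where
    field
      slot           : Bool → Fin m → Fin N
      slot-injective : ∀ b → Injective _≡_ _≡_ (slot b)
      slot∈side      : ∀ b p → slot b p ∈ side b
  open Slots public

  slots : ∀ {m} → m ≤ ∣ A ∣ → m ≤ ∣ B ∣ → Slots m
  slots {m} m≤A m≤B = record { slot = slot′ ; slot-injective = injective′ ; slot∈side = ∈side }
    where
    slot′ : Bool → Fin m → Fin N
    slot′ true p = elementOf A (inject≤ p m≤A)
    slot′ false p = elementOf B (inject≤ p m≤B)
    injective′ : ∀ b → Injective _≡_ _≡_ (slot′ b)
    injective′ true eq = Fin.inject≤-injective m≤A m≤A _ _ (elementOf-injective A eq)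
    injective′ false eq = Fin.inject≤-injective m≤B m≤B _ _ (elementOf-injective B eq)
    ∈side : ∀ b p → slot′ b p ∈ side b
    ∈side true p = elementOf-∈ A _
    ∈side false p = elementOf-∈ B _

  opposite-slots-adjacent : ∀ {m} (S : Slots m) {b b'} p q → b' ≡ not b → Edge G (slot S b p) (slot S b' q)
  opposite-slots-adjacent S {b} p q refl = side-complete b (slot∈side S b p) (slot∈side S (not b) q)

  same-side-slots-nonadjacent : ∀ {m} (S : Slots m) {b b'} p q → b ≡ b' → ¬ Edge G (slot S b p) (slot S b' q)
  same-side-slots-nonadjacent S {b} p q refl = side-independent b (slot∈side S b p) (slot∈side S b q)

  data Target : Set where
    slotted : Bool → Target
    fixed   : Fin N → Target

  fixed-injective : ∀ {y y'} → fixed y ≡ fixed y' → y ≡ y'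
  fixed-injective refl = refl

  realise : ∀ {m} → Slots m → Fin m → Target → Fin N
  realise S p (slotted b) = slot S b p
  realise S _ (fixed y) = y

  module _ {m} {V : Set} {Adj : V → V → Set} (code : V → Fin m) (code-injective : Injective _≡_ _≡_ code)
           (S : Slots m) (τ : V → Target) where

    FixedOutside FixedUnique : Set
    FixedOutside = ∀ {v y} → τ v ≡ fixed y → y ∉ A ∪ B
    FixedUnique = ∀ {a b y} → τ a ≡ fixed y → τ b ≡ fixed y → a ≡ b

    realise-injective : FixedOutside → FixedUnique → Injective _≡_ _≡_ (λ v → realise S (code v) (τ v))
    realise-injective outside fixed-unique {a} {b} eq with τ a in τa | τ b in τb
    ... | slotted c | slotted c' with c Bool.≟ c'
    ...   | yes refl = code-injective (slot-injective S c eq)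
    ...   | no c≢c' = ⊥-elim (sides-disjoint c (slot∈side S c _) (subst (_∈ side (not c)) (sym eq) c'-side))
      where
      c'-side : slot S c' (code b) ∈ side (not c)
      c'-side = subst (λ d → slot S c' _ ∈ side d) (Bool.¬-not (c≢c' ∘ sym)) (slot∈side S c' _)
    realise-injective outside _ eq | slotted c | fixed y =
      ⊥-elim (outside τb (subst (_∈ A ∪ B) eq (side⊆U c (slot∈side S c _))))
    realise-injective outside _ eq | fixed y | slotted c =
      ⊥-elim (outside τa (subst (_∈ A ∪ B) (sym eq) (side⊆U c (slot∈side S c _))))
    realise-injective _ fixed-unique eq | fixed y | fixed y' = fixed-unique τa (trans τb (cong fixed (sym eq)))

    targetEmbedding : FixedOutside → FixedUnique →
      (∀ {a b} → Adj a b → Edge G (realise S (code a) (τ a)) (realise S (code b) (τ b))) → Embedding G Adj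
    targetEmbedding outside fixed-unique adjacent = record
      { map = λ v → realise S (code v) (τ v)
      ; injective = realise-injective outside fixed-unique
      ; adjacent = adjacent }

  bipartiteEmbedding : ∀ {m} {V : Set} {Adj : V → V → Set} (code : V → Fin m) → Injective _≡_ _≡_ code →
    Slots m → (col : V → Bool) → ProperColouring Adj col → Embedding G Adj
  bipartiteEmbedding code code-injective S col proper =
    targetEmbedding code code-injective S (λ v → slotted (col v)) (λ ()) (λ ())
      (λ ab → opposite-slots-adjacent S _ _ (proper ab))

  put : ∀ {m} (S : Slots m) (b : Bool) (p : Fin m) (e : Fin N) → e ∈ side b → Slots m
  put {m} S b p e e∈b = record { slot = slot′ ; slot-injective = injective′ ; slot∈side = ∈side }
    where
    slot′ : Bool → Fin m → Fin N
    slot′ b' with b Bool.≟ b'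
    ... | yes _ = overwrite (slot S b') p e
    ... | no _ = slot S b'
    injective′ : ∀ b' → Injective _≡_ _≡_ (slot′ b')
    injective′ b' with b Bool.≟ b'
    ... | yes _ = overwrite-injective (slot S b') (slot-injective S b')
    ... | no _ = slot-injective S b'
    ∈side : ∀ b' q → slot′ b' q ∈ side b'
    ∈side b' with b Bool.≟ b'
    ... | yes refl = overwrite-∈ (slot S b) (side b) (slot∈side S b) e∈b
    ... | no _ = slot∈side S b'

  put-at : ∀ {m} (S : Slots m) b p e (e∈b : e ∈ side b) → slot (put S b p e e∈b) b p ≡ e
  put-at S b p e _ with b Bool.≟ b
  ... | yes _ = overwrite-at (slot S b) p e
  ... | no b≢b = ⊥-elim (b≢b refl)

  put-elsewhere : ∀ {m} (S : Slots m) b p e (e∈b : e ∈ side b) b' {q} → q ≢ p → slot S b' q ≢ e →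
    slot (put S b p e e∈b) b' q ≡ slot S b' q
  put-elsewhere S b p e _ b' q≢p ≢e with b Bool.≟ b'
  ... | yes _ = overwrite-elsewhere (slot S b') q≢p ≢e
  ... | no _ = refl

-- Detours

module Paths (G : Graph) where

  private
    N : ℕ
    N = n G

  data Chain : Fin N → List (Fin N) → Fin N → Set where
    end : ∀ {a z} → Edge G a z → Chain a [] z
    via : ∀ {a b bs z} → Edge G a b → Chain b bs z → Chain a (b ∷ bs) z

  record Detour (U : Subset N) (x z : Fin N) : Set where
    field
      interior   : List (Fin N)
      chain      : Chain x interior z
      unique     : Unique interior
      x∉interior : x ∉ₗ interior
      outside    : All (_∉ U) interior
  open Detour public

  direct : ∀ {U x z} → Edge G x z → Detour U x z
  direct xz = record { interior = [] ; chain = end xz ; unique = [] ; x∉interior = λ () ; outside = [] }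

  private
    shortcut : ∀ {U a b z} (D : Detour U b z) → a ∈ₗ interior D → Detour U a z
    shortcut record { chain = via _ ch ; unique = b∉bs ∷ uniq ; outside = _ ∷ out } (here refl) =
      record { interior = _ ; chain = ch ; unique = uniq ; x∉interior = All¬⇒¬Any b∉bs ; outside = out }
    shortcut record { chain = via _ ch ; unique = b∉bs ∷ uniq ; outside = _ ∷ out } (there a∈bs) =
      shortcut (record { interior = _ ; chain = ch ; unique = uniq ; x∉interior = All¬⇒¬Any b∉bs ; outside = out })
               a∈bs

  walk⇒detour : ∀ (U : Subset N) u {a c} → a ∉ U → WalkAvoiding G u a c → c ∈ U →
    Σ (Fin N) λ z → Detour U a z × z ∈ U × z ≢ u
  walk⇒detour U u a∉U here c∈U = ⊥-elim (a∉U c∈U)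
  walk⇒detour U u {a} a∉U (step {b = b} ab b≢u walk) c∈U with b ∈? U
  ... | yes b∈U = b , direct ab , b∈U , b≢u
  ... | no b∉U with walk⇒detour U u b∉U walk c∈U
  ... | z , D , z∈U , z≢u with any? (a Fin.≟_) (interior D)
  ...   | yes a∈ = z , shortcut D a∈ , z∈U , z≢u
  ...   | no a∉ = z , record
          { interior = b ∷ interior D
          ; chain = via ab (chain D)
          ; unique = ¬Any⇒All¬ _ (x∉interior D) ∷ unique D
          ; x∉interior = λ { (here a≡b) → edge-irreflexive G ab a≡b ; (there a∈) → a∉ a∈ }
          ; outside = b∉U ∷ outside D } , z∈U , z≢u

  nth : List (Fin N) → Fin N → ℕ → Fin N
  nth [] z _ = z
  nth (b ∷ bs) z zero = b
  nth (b ∷ bs) z (suc m) = nth bs z m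

  private
    nth-∈ : ∀ bs z {m} → m < length bs → nth bs z m ∈ₗ bs
    nth-∈ (b ∷ bs) z {zero} _ = here refl
    nth-∈ (b ∷ bs) z {suc m} (s≤s m<) = there (nth-∈ bs z m<)

  chain-start : ∀ {a bs z} → Chain a bs z → Edge G a (nth bs z 0)
  chain-start (end az) = az
  chain-start (via ab _) = ab

  chain-step : ∀ {a bs z} → Chain a bs z → ∀ {m} → m < length bs → Edge G (nth bs z m) (nth bs z (suc m))
  chain-step (via _ ch) {zero} _ = chain-start ch
  chain-step (via _ ch) {suc m} (s≤s m<) = chain-step ch m<

  nth-length : ∀ bs z → nth bs z (length bs) ≡ z
  nth-length [] z = refl
  nth-length (b ∷ bs) z = nth-length bs z

  nth-All : ∀ {P : Fin N → Set} {bs} z → All P bs → ∀ {m} → m < length bs → P (nth bs z m)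
  nth-All z (p ∷ _) {zero} _ = p
  nth-All z (_ ∷ ps) {suc m} (s≤s m<) = nth-All z ps m<

  nth-∉ : ∀ {a} bs z → a ∉ₗ bs → ∀ {m} → m < length bs → nth bs z m ≢ a
  nth-∉ bs z a∉ m< refl = a∉ (nth-∈ bs z m<)

  nth-injective : ∀ {bs} z → Unique bs → ∀ {m m'} → m < length bs → m' < length bs →
    nth bs z m ≡ nth bs z m' → m ≡ m'
  nth-injective z (_ ∷ _) {zero} {zero} _ _ _ = refl
  nth-injective {b ∷ bs} z (b∉ ∷ _) {zero} {suc m'} _ (s≤s m'<) eq = ⊥-elim (All.lookup b∉ (nth-∈ bs z m'<) eq)
  nth-injective {b ∷ bs} z (b∉ ∷ _) {suc m} {zero} (s≤s m<) _ eq = ⊥-elim (All.lookup b∉ (nth-∈ bs z m<) (sym eq))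
  nth-injective z (_ ∷ uniq) {suc m} {suc m'} (s≤s m<) (s≤s m'<) eq = cong suc (nth-injective z uniq m< m'< eq)

-- The spiders of t S_{t,t,t}

parity : ℕ → Bool
parity zero = false
parity (suc m) = not (parity m)

depth : ∀ {t} → tSttt-V t → ℕ
depth (_ , nothing) = zero
depth (_ , just (_ , i)) = suc (toℕ i)

tSttt-search : ∀ t → Searchable (tSttt-V t)
tSttt-search t = search-× Fin.any? (search-Maybe (search-× Fin.any? Fin.any?))

tSttt-size : ℕ → ℕ
tSttt-size t = t * suc (3 * t)

leg-code : ∀ {t} → Maybe (Fin 3 × Fin t) → Fin (suc (3 * t))
leg-code nothing = zero
leg-code (just (j , i)) = suc (combine j i)

leg-code-injective : ∀ {t} → Injective _≡_ _≡_ (leg-code {t})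
leg-code-injective {x = nothing} {nothing} _ = refl
leg-code-injective {x = just (j , i)} {just (j' , i')} eq
  with Fin.combine-injectiveˡ j i j' i' (Fin.suc-injective eq) | Fin.combine-injectiveʳ j i j' i' (Fin.suc-injective eq)
... | refl | refl = refl

tSttt-code : ∀ {t} → tSttt-V t → Fin (tSttt-size t)
tSttt-code (c , m) = combine c (leg-code m)

tSttt-code-injective : ∀ {t} → Injective _≡_ _≡_ (tSttt-code {t})
tSttt-code-injective {x = c , m} {c' , m'} eq
  with Fin.combine-injectiveˡ c _ c' _ eq | leg-code-injective (Fin.combine-injectiveʳ c _ c' _ eq)
... | refl | refl = refl

tSttt-adj? : ∀ {t} → B.Decidable (tSttt-Adj t)
tSttt-adj? (c , nothing) (c' , nothing) = no λ ()
tSttt-adj? (c , nothing) (c' , just (j , i)) with c Fin.≟ c' | toℕ i ℕ.≟ 0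
... | yes refl | yes i≡0 = yes (centre-leg c j i i≡0)
... | no c≢c' | _ = no λ { (centre-leg _ _ _ _) → c≢c' refl }
... | yes _ | no i≢0 = no λ { (centre-leg _ _ _ i≡0) → i≢0 i≡0 }
tSttt-adj? (c , just (j , i)) (c' , nothing) with c Fin.≟ c' | toℕ i ℕ.≟ 0
... | yes refl | yes i≡0 = yes (leg-centre c j i i≡0)
... | no c≢c' | _ = no λ { (leg-centre _ _ _ _) → c≢c' refl }
... | yes _ | no i≢0 = no λ { (leg-centre _ _ _ i≡0) → i≢0 i≡0 }
tSttt-adj? (c , just (j , i)) (c' , just (j' , i'))
  with c Fin.≟ c' | j Fin.≟ j' | suc (toℕ i) ℕ.≟ toℕ i' | suc (toℕ i') ℕ.≟ toℕ i
... | yes refl | yes refl | yes next | _ = yes (leg-next c j i i' next)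
... | yes refl | yes refl | no _ | yes prev = yes (leg-prev c j i' i prev)
... | yes refl | yes refl | no ¬next | no ¬prev =
  no λ { (leg-next _ _ _ _ next) → ¬next next ; (leg-prev _ _ _ _ prev) → ¬prev prev }
... | no c≢c' | _ | _ | _ = no λ { (leg-next _ _ _ _ _) → c≢c' refl ; (leg-prev _ _ _ _ _) → c≢c' refl }
... | yes _ | no j≢j' | _ | _ = no λ { (leg-next _ _ _ _ _) → j≢j' refl ; (leg-prev _ _ _ _ _) → j≢j' refl }

tSttt-adj-sym : ∀ {t a b} → tSttt-Adj t a b → tSttt-Adj t b a
tSttt-adj-sym (centre-leg c j i i≡0) = leg-centre c j i i≡0
tSttt-adj-sym (leg-centre c j i i≡0) = centre-leg c j i i≡0
tSttt-adj-sym (leg-next c j i i' next) = leg-prev c j i i' next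
tSttt-adj-sym (leg-prev c j i i' next) = leg-next c j i i' next

tSttt-adj-component : ∀ {t a b} → tSttt-Adj t a b → proj₁ a ≡ proj₁ b
tSttt-adj-component (centre-leg _ _ _ _) = refl
tSttt-adj-component (leg-centre _ _ _ _) = refl
tSttt-adj-component (leg-next _ _ _ _ _) = refl
tSttt-adj-component (leg-prev _ _ _ _ _) = refl

depth-parity-proper : ∀ {t} → ProperColouring (tSttt-Adj t) (λ v → parity (depth v))
depth-parity-proper (centre-leg c j i i≡0) rewrite i≡0 = refl
depth-parity-proper (leg-centre c j i i≡0) rewrite i≡0 = refl
depth-parity-proper (leg-next c j i i' next) rewrite sym next = refl
depth-parity-proper (leg-prev c j i i' next) rewrite sym next = sym (Bool.not-involutive _)

twisted-parity-proper : ∀ {t} (flip : Fin t → Bool) →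
  ProperColouring (tSttt-Adj t) (λ v → parity (depth v) xor flip (proj₁ v))
twisted-parity-proper flip {a} {b} ab rewrite tSttt-adj-component ab | depth-parity-proper ab =
  sym (Bool.not-distribˡ-xor (parity (depth a)) (flip (proj₁ b)))

tSttt-size-expanded : ∀ t → t * suc (3 * t) ≡ 3 * (t * t) + t
tSttt-size-expanded = solve-∀

tSttt-size-bound : ∀ t → tSttt-size t ≤ 3 * (t * t) + t + 1
tSttt-size-bound t = ℕ.≤-trans (ℕ.≤-reflexive (tSttt-size-expanded t)) (ℕ.m≤m+n _ 1)

2<tSttt-size : ∀ t → 2 < tSttt-size (suc t)
2<tSttt-size t rewrite tSttt-size-expanded (suc t) = ℕ.≤-trans (ℕ.m≤m*n 3 (suc t * suc t)) (ℕ.m≤m+n _ (suc t))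

-- The part of the spider c that stays attached to its centre when the leg vertex
-- (c , just (j , i)) is removed.
data Inside {t} (c : Fin t) (j : Fin 3) (i : Fin t) : tSttt-V t → Set where
  centre    : Inside c j i (c , nothing)
  other-leg : ∀ {j' i'} → j' ≢ j → Inside c j i (c , just (j' , i'))
  below     : ∀ {i'} → toℕ i' < toℕ i → Inside c j i (c , just (j , i'))

data Region {t} (c : Fin t) (j : Fin 3) (i : Fin t) : tSttt-V t → Set where
  elsewhere : ∀ {c' m} → c' ≢ c → Region c j i (c' , m)
  at        : Region c j i (c , just (j , i))
  beyond    : ∀ {i'} → toℕ i < toℕ i' → Region c j i (c , just (j , i'))
  inside    : ∀ {v} → Inside c j i v → Region c j i v

region : ∀ {t} (c : Fin t) j i v → Region c j i v
region c j i (c' , m) with c' Fin.≟ c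
... | no c'≢c = elsewhere c'≢c
region c j i (c , nothing) | yes refl = inside centre
region c j i (c , just (j' , i')) | yes refl with j' Fin.≟ j
... | no j'≢j = inside (other-leg j'≢j)
... | yes refl with ℕ.<-cmp (toℕ i') (toℕ i)
...   | tri< i'<i _ _ = inside (below i'<i)
...   | tri≈ _ i'≡i _ rewrite Fin.toℕ-injective i'≡i = at
...   | tri> _ _ i<i' = beyond i<i'

inside-component : ∀ {t} {c : Fin t} {j i v} → Inside c j i v → proj₁ v ≡ c
inside-component centre = refl
inside-component (other-leg _) = refl
inside-component (below _) = refl

inside-not-beyond : ∀ {t} {c : Fin t} {j i v i'} → Inside c j i v → toℕ i ≤ toℕ i' → v ≢ (c , just (j , i'))
inside-not-beyond (other-leg j'≢j) _ refl = j'≢j refl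
inside-not-beyond (below i'<i) i≤i' refl = ℕ.<-irrefl refl (ℕ.<-≤-trans i'<i i≤i')

predecessor : ∀ {t} → Fin t → Fin 3 → Fin t → tSttt-V t
predecessor c j zero = (c , nothing)
predecessor c j (suc i) = (c , just (j , inject₁ i))

predecessor-depth : ∀ {t} (c : Fin t) j i → depth (predecessor c j i) ≡ toℕ i
predecessor-depth c j zero = refl
predecessor-depth c j (suc i) = cong suc (Fin.toℕ-inject₁ i)

predecessor-inside : ∀ {t} (c : Fin t) j i → Inside c j i (predecessor c j i)
predecessor-inside c j zero = centre
predecessor-inside c j (suc i) = below (subst (_< suc (toℕ i)) (sym (Fin.toℕ-inject₁ i)) (ℕ.n<1+n _))

predecessor-adjacent : ∀ {t} (c : Fin t) j i → tSttt-Adj t (predecessor c j i) (c , just (j , i))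
predecessor-adjacent c j zero = centre-leg c j zero refl
predecessor-adjacent c j (suc i) = leg-next c j (inject₁ i) (suc i) (cong suc (Fin.toℕ-inject₁ i))

predecessor-of-first : ∀ {t} (c : Fin t) j i → toℕ i ≡ 0 → predecessor c j i ≡ (c , nothing)
predecessor-of-first c j zero _ = refl

predecessor-of-next : ∀ {t} (c : Fin t) j {i₁} i → suc (toℕ i₁) ≡ toℕ i →
  predecessor c j i ≡ (c , just (j , i₁))
predecessor-of-next c j (suc i) next =
  cong (λ i₀ → (c , just (j , i₀))) (Fin.toℕ-injective (trans (Fin.toℕ-inject₁ i) (sym (ℕ.suc-injective next))))

-- An edge directed away from the centre, seen from the leg vertex (c , just (j , i)).
data Configuration {t} (c : Fin t) (j : Fin 3) (i : Fin t) : tSttt-V t → tSttt-V t → Set where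
  both-elsewhere : ∀ {c' m m'} → c' ≢ c → Configuration c j i (c' , m) (c' , m')
  both-inside    : ∀ {a b} → Inside c j i a → Inside c j i b → Configuration c j i a b
  entering       : Configuration c j i (predecessor c j i) (c , just (j , i))
  leaving        : ∀ {i'} → toℕ i' ≡ suc (toℕ i) → Configuration c j i (c , just (j , i)) (c , just (j , i'))
  trailing       : ∀ {i₁ i₂} → toℕ i < toℕ i₁ → suc (toℕ i₁) ≡ toℕ i₂ →
                   Configuration c j i (c , just (j , i₁)) (c , just (j , i₂))

outward-configuration : ∀ {t} (c : Fin t) j i {a b} → tSttt-Adj t a b →
  Configuration c j i a b ⊎ Configuration c j i b a
outward-configuration c j i (centre-leg c' j' i' i'≡0) with c' Fin.≟ c
... | no c'≢c = inj₁ (both-elsewhere c'≢c)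
... | yes refl with j' Fin.≟ j
...   | no j'≢j = inj₁ (both-inside centre (other-leg j'≢j))
...   | yes refl with toℕ i ℕ.≟ 0
...     | yes i≡0 rewrite Fin.toℕ-injective (trans i'≡0 (sym i≡0)) =
          inj₁ (subst (λ v → Configuration c j i v _) (predecessor-of-first c j i i≡0) entering)
...     | no i≢0 = inj₁ (both-inside centre (below (subst (_< toℕ i) (sym i'≡0) (ℕ.n≢0⇒n>0 i≢0))))
outward-configuration c j i (leg-next c' j' i₁ i₂ next) with c' Fin.≟ c
... | no c'≢c = inj₁ (both-elsewhere c'≢c)
... | yes refl with j' Fin.≟ j
...   | no j'≢j = inj₁ (both-inside (other-leg j'≢j) (other-leg j'≢j))
...   | yes refl with ℕ.<-cmp (toℕ i₁) (toℕ i)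
...     | tri≈ _ i₁≡i _ rewrite Fin.toℕ-injective i₁≡i = inj₁ (leaving (sym next))
...     | tri> _ _ i<i₁ = inj₁ (trailing i<i₁ next)
...     | tri< i₁<i _ _ with ℕ.<-cmp (toℕ i₂) (toℕ i)
...       | tri< i₂<i _ _ = inj₁ (both-inside (below i₁<i) (below i₂<i))
...       | tri≈ _ i₂≡i _ rewrite Fin.toℕ-injective i₂≡i =
            inj₁ (subst (λ v → Configuration c j i v _) (predecessor-of-next c j i next) entering)
...       | tri> _ _ i<i₂ = ⊥-elim (ℕ.<⇒≱ i₁<i (ℕ.≤-pred (subst (toℕ i <_) (sym next) i<i₂)))
outward-configuration c j i (leg-centre c' j' i' i'≡0) =
  Data.Sum.swap (outward-configuration c j i (centre-leg c' j' i' i'≡0))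
outward-configuration c j i (leg-prev c' j' i₁ i₂ next) =
  Data.Sum.swap (outward-configuration c j i (leg-next c' j' i₁ i₂ next))

-- A vertex outside A ∪ B that splits it

module Splitting (G : Graph) {A B : Subset (n G)} (K : InducedCompleteBipartite G A B) where
  open CompleteBipartite G K
  open Paths G

  private
    N : ℕ
    N = n G

  record Splitter : Set where
    field
      x u w z : Fin N
      Y Z     : Bool
      x∉U     : x ∉ A ∪ B
      u∈Y     : u ∈ side Y
      w∈Y     : w ∈ side Y
      z∈Z     : z ∈ side Z
      xu      : Edge G x u
      ¬xw     : ¬ Edge G x w
      z≢u     : z ≢ u
      z≢w     : z ≢ w
      detour  : Detour (A ∪ B) x z

  -- The embedding sends s to x, its predecessor to u and s' to w; the leg beyond s follows the
  -- detour and, from z on, alternates between the sides; everything else is coloured bipartitely.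
  module AlongLeg {t : ℕ} (S : Slots (tSttt-size t)) (D : Splitter)
                  (c : Fin t) (j : Fin 3) (i : Fin t) {s' : tSttt-V t} (s'-inside : Inside c j i s')
                  (s'≁s : ¬ tSttt-Adj t s' (c , just (j , i))) (s'-parity : parity (depth s') ≡ parity (toℕ i)) where
    open Splitter D

    private
      code : tSttt-V t → Fin (tSttt-size t)
      code = tSttt-code

    s h : tSttt-V t
    s = (c , just (j , i))
    h = predecessor c j i

    L : ℕ
    L = length (interior detour)

    -- along m is the vertex at distance m + 1 from x on the detour, so along L = z.
    along : ℕ → Fin N
    along = nth (interior detour) z

    offset : Fin t → ℕ
    offset i' = toℕ i' ∸ suc (toℕ i)

    IsReentry : Fin t → Set
    IsReentry i' = toℕ i' ≡ suc (toℕ i + L)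

    reentry? : Dec (∃ IsReentry)
    reentry? = Fin.any? (λ i' → toℕ i' ℕ.≟ suc (toℕ i + L))

    slotsWithZ : Dec (∃ IsReentry) → Slots (tSttt-size t)
    slotsWithZ (yes (i' , _)) = put S Z (code (c , just (j , i'))) z z∈Z
    slotsWithZ (no _) = S

    slotsWithZU : Slots (tSttt-size t)
    slotsWithZU = put (slotsWithZ reentry?) Y (code h) u u∈Y

    slots′ : Slots (tSttt-size t)
    slots′ = put slotsWithZU Y (code s') w w∈Y

    h≢s' : h ≢ s'
    h≢s' h≡s' = s'≁s (subst (λ v → tSttt-Adj t v s) h≡s' (predecessor-adjacent c j i))

    u≢w : u ≢ w
    u≢w u≡w = ¬xw (subst (Edge G x) u≡w xu)

    slot′-s' : slot slots′ Y (code s') ≡ w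
    slot′-s' = put-at slotsWithZU Y (code s') w w∈Y

    slot′-h : slot slots′ Y (code h) ≡ u
    slot′-h = trans (put-elsewhere slotsWithZU Y (code s') w w∈Y Y (h≢s' ∘ tSttt-code-injective)
                       λ eq → u≢w (trans (sym at-h) eq))
                    at-h
      where
      at-h : slot slotsWithZU Y (code h) ≡ u
      at-h = put-at (slotsWithZ reentry?) Y (code h) u u∈Y

    slot′-reentry : ∀ {i'} → IsReentry i' → slot slots′ Z (code (c , just (j , i'))) ≡ z
    slot′-reentry {i'} reentry =
      trans (put-elsewhere slotsWithZU Y (code s') w w∈Y Z (not-inside s'-inside ∘ tSttt-code-injective)
              λ eq → z≢w (trans (sym withZU) eq))
            withZU
      where
      i≤i' : toℕ i ≤ toℕ i'
      i≤i' = ℕ.≤-trans (ℕ.m≤m+n (toℕ i) L) (ℕ.≤-trans (ℕ.n≤1+n _) (ℕ.≤-reflexive (sym reentry)))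
      not-inside : ∀ {v} → Inside c j i v → (c , just (j , i')) ≢ v
      not-inside v-inside eq = inside-not-beyond v-inside i≤i' (sym eq)
      withZ : ∀ d → slot (slotsWithZ d) Z (code (c , just (j , i'))) ≡ z
      withZ (yes (i'' , reentry')) rewrite Fin.toℕ-injective (trans reentry (sym reentry')) =
        put-at S Z (code (c , just (j , i''))) z z∈Z
      withZ (no ¬reentry) = ⊥-elim (¬reentry (i' , reentry))
      withZU : slot slotsWithZU Z (code (c , just (j , i'))) ≡ z
      withZU = trans (put-elsewhere (slotsWithZ reentry?) Y (code h) u u∈Y Z
                        (not-inside (predecessor-inside c j i) ∘ tSttt-code-injective)
                        λ eq → z≢u (trans (sym (withZ reentry?)) eq))
                     (withZ reentry?)

    insideColour : tSttt-V t → Bool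
    insideColour v = Y xor (parity (depth v) xor parity (toℕ i))

    insideColour-proper : ProperColouring (tSttt-Adj t) insideColour
    insideColour-proper {a} ab rewrite depth-parity-proper ab =
      trans (cong (Y xor_) (sym (Bool.not-distribˡ-xor (parity (depth a)) (parity (toℕ i)))))
            (sym (Bool.not-distribʳ-xor Y _))

    insideColour-h : insideColour h ≡ Y
    insideColour-h rewrite predecessor-depth c j i | Bool.xor-same (parity (toℕ i)) = Bool.xor-identityʳ Y

    insideColour-s' : insideColour s' ≡ Y
    insideColour-s' rewrite s'-parity | Bool.xor-same (parity (toℕ i)) = Bool.xor-identityʳ Y

    trail : (m : ℕ) → Dec (m < L) → Target
    trail m (yes _) = fixed (along m)
    trail m (no _) = slotted (Z xor parity (m ∸ L))

    target : ∀ {v} → Region c j i v → Target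
    target {v} (elsewhere _) = slotted (parity (depth v))
    target at = fixed x
    target (beyond {i'} _) = trail (offset i') (offset i' ℕ.<? L)
    target {v} (inside _) = slotted (insideColour v)

    τ : tSttt-V t → Target
    τ v = target (region c j i v)

    τ-elsewhere : ∀ {c' m} → c' ≢ c → τ (c' , m) ≡ slotted (parity (depth (c' , m)))
    τ-elsewhere {c'} {m} c'≢c with region c j i (c' , m)
    ... | elsewhere _ = refl
    ... | at = ⊥-elim (c'≢c refl)
    ... | beyond _ = ⊥-elim (c'≢c refl)
    ... | inside v-inside = ⊥-elim (c'≢c (inside-component v-inside))

    τ-inside : ∀ {v} → Inside c j i v → τ v ≡ slotted (insideColour v)
    τ-inside {v} v-inside with region c j i v
    ... | elsewhere c'≢c = ⊥-elim (c'≢c (inside-component v-inside))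
    ... | at = ⊥-elim (inside-not-beyond v-inside ℕ.≤-refl refl)
    ... | beyond i<i' = ⊥-elim (inside-not-beyond v-inside (ℕ.<⇒≤ i<i') refl)
    ... | inside _ = refl

    τ-at : τ s ≡ fixed x
    τ-at with region c j i s
    ... | elsewhere c≢c = ⊥-elim (c≢c refl)
    ... | at = refl
    ... | beyond i<i = ⊥-elim (ℕ.<-irrefl refl i<i)
    ... | inside s-inside = ⊥-elim (inside-not-beyond s-inside ℕ.≤-refl refl)

    τ-beyond : ∀ {i'} → toℕ i < toℕ i' → τ (c , just (j , i')) ≡ trail (offset i') (offset i' ℕ.<? L)
    τ-beyond {i'} i<i' with region c j i (c , just (j , i'))
    ... | elsewhere c≢c = ⊥-elim (c≢c refl)
    ... | at = ⊥-elim (ℕ.<-irrefl refl i<i')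
    ... | beyond _ = refl
    ... | inside v-inside = ⊥-elim (inside-not-beyond v-inside (ℕ.<⇒≤ i<i') refl)

    f : tSttt-V t → Fin N
    f v = realise slots′ (code v) (τ v)

    offset-injective : ∀ {i₁ i₂} → toℕ i < toℕ i₁ → toℕ i < toℕ i₂ →
      offset i₁ ≡ offset i₂ → i₁ ≡ i₂
    offset-injective i<i₁ i<i₂ eq = Fin.toℕ-injective (ℕ.∸-cancelʳ-≡ i<i₁ i<i₂ eq)

    offset-next : ∀ {i₁ i₂} → toℕ i < toℕ i₁ → suc (toℕ i₁) ≡ toℕ i₂ →
      offset i₂ ≡ suc (offset i₁)
    offset-next i<i₁ next = trans (cong (_∸ suc (toℕ i)) (sym next)) (ℕ.+-∸-assoc 1 i<i₁)

    beyond-next : ∀ {i₁ i₂ : Fin t} → toℕ i < toℕ i₁ → suc (toℕ i₁) ≡ toℕ i₂ → toℕ i < toℕ i₂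
    beyond-next i<i₁ next = ℕ.<-trans i<i₁ (ℕ.≤-reflexive next)

    reentry-value : ∀ {i'} → toℕ i < toℕ i' → offset i' ≡ L →
      slot slots′ (Z xor parity (offset i' ∸ L)) (code (c , just (j , i'))) ≡ z
    reentry-value {i'} i<i' off≡L rewrite off≡L | ℕ.n∸n≡0 L | Bool.xor-identityʳ Z = slot′-reentry reentry
      where
      reentry : IsReentry i'
      reentry = begin
        toℕ i'                  ≡⟨ ℕ.m∸n+n≡m i<i' ⟨
        offset i' + suc (toℕ i) ≡⟨ cong (_+ suc (toℕ i)) off≡L ⟩
        L + suc (toℕ i)         ≡⟨ ℕ.+-comm L (suc (toℕ i)) ⟩
        suc (toℕ i + L)         ∎
        where open ≡-Reasoning

    along≢x : ∀ {m} → m < L → along m ≢ x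
    along≢x = nth-∉ _ z (x∉interior detour)

    along-L : along L ≡ z
    along-L = nth-length (interior detour) z

    offset-leaving : ∀ {i'} → toℕ i' ≡ suc (toℕ i) → offset i' ≡ 0
    offset-leaving leave = trans (cong (_∸ suc (toℕ i)) leave) (ℕ.n∸n≡0 (suc (toℕ i)))

    trail-first : ∀ {i'} → toℕ i' ≡ suc (toℕ i) → (d : Dec (offset i' < L)) →
      Edge G x (realise slots′ (code (c , just (j , i'))) (trail (offset i') d))
    trail-first leave (yes _) =
      subst (λ m → Edge G x (along m)) (sym (offset-leaving leave)) (chain-start (chain detour))
    trail-first leave (no ¬off<L) = subst (Edge G x) (sym (reentry-value (ℕ.≤-reflexive (sym leave)) off≡L)) x-z
      where
      off≡L : _ ≡ L
      off≡L = trans (offset-leaving leave)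
                    (sym (ℕ.n≤0⇒n≡0 (subst (L ≤_) (offset-leaving leave) (ℕ.≮⇒≥ ¬off<L))))
      x-z : Edge G x z
      x-z = subst (Edge G x) (trans (cong along (trans (sym (offset-leaving leave)) off≡L)) along-L)
                  (chain-start (chain detour))

    trail-step : ∀ {i₁ i₂} → toℕ i < toℕ i₁ → (next : suc (toℕ i₁) ≡ toℕ i₂) →
      (d₁ : Dec (offset i₁ < L)) (d₂ : Dec (offset i₂ < L)) →
      Edge G (realise slots′ (code (c , just (j , i₁))) (trail (offset i₁) d₁))
             (realise slots′ (code (c , just (j , i₂))) (trail (offset i₂) d₂))
    trail-step {i₁} {i₂} i<i₁ next (yes m<L) (yes _) =
      subst (λ m → Edge G (along (offset i₁)) (along m)) (sym (offset-next i<i₁ next)) (chain-step (chain detour) m<L)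
    trail-step {i₁} {i₂} i<i₁ next (yes m<L) (no ¬m+1<L) =
      subst (Edge G (along (offset i₁))) (sym (reentry-value (beyond-next i<i₁ next) off₂≡L)) step-to-z
      where
      m+1≡L : suc (offset i₁) ≡ L
      m+1≡L = ℕ.≤-antisym m<L (subst (L ≤_) (offset-next i<i₁ next) (ℕ.≮⇒≥ ¬m+1<L))
      off₂≡L : offset i₂ ≡ L
      off₂≡L = trans (offset-next i<i₁ next) m+1≡L
      step-to-z : Edge G (along (offset i₁)) z
      step-to-z = subst (Edge G (along (offset i₁))) (trans (cong along m+1≡L) along-L) (chain-step (chain detour) m<L)
    trail-step i<i₁ next (no ¬m<L) (yes m+1<L) =
      ⊥-elim (¬m<L (ℕ.<-trans (ℕ.n<1+n _) (subst (_< L) (offset-next i<i₁ next) m+1<L)))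
    trail-step {i₁} {i₂} i<i₁ next (no ¬m<L) (no _) = opposite-slots-adjacent slots′ _ _ flips
      where
      flips : Z xor parity (offset i₂ ∸ L) ≡ not (Z xor parity (offset i₁ ∸ L))
      flips rewrite offset-next i<i₁ next | ℕ.+-∸-assoc 1 (ℕ.≮⇒≥ ¬m<L) = sym (Bool.not-distribʳ-xor Z _)

    configuration-edge : ∀ {a b} → Configuration c j i a b → tSttt-Adj t a b → Edge G (f a) (f b)
    configuration-edge (both-elsewhere {c'} {m} {m'} c'≢c) ab
      rewrite τ-elsewhere {c'} {m} c'≢c | τ-elsewhere {c'} {m'} c'≢c =
      opposite-slots-adjacent slots′ _ _ (depth-parity-proper ab)
    configuration-edge (both-inside a-inside b-inside) ab rewrite τ-inside a-inside | τ-inside b-inside =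
      opposite-slots-adjacent slots′ _ _ (insideColour-proper ab)
    configuration-edge entering _ rewrite τ-inside (predecessor-inside c j i) | τ-at | insideColour-h =
      subst (λ v → Edge G v x) (sym slot′-h) (edge-sym G xu)
    configuration-edge (leaving {i'} leave) _ rewrite τ-at | τ-beyond {i'} (ℕ.≤-reflexive (sym leave)) =
      trail-first leave (offset i' ℕ.<? L)
    configuration-edge (trailing {i₁} {i₂} i<i₁ next) _
      rewrite τ-beyond {i₁} i<i₁ | τ-beyond {i₂} (beyond-next i<i₁ next) =
      trail-step i<i₁ next (offset i₁ ℕ.<? L) (offset i₂ ℕ.<? L)

    τ-fixed : ∀ {v y} → τ v ≡ fixed y →
      (v ≡ s × y ≡ x) ⊎
      Σ (Fin t) λ i' → v ≡ (c , just (j , i')) × toℕ i < toℕ i' × offset i' < L × along (offset i') ≡ y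
    τ-fixed {v} eq with region c j i v
    ... | at = inj₁ (refl , fixed-injective (sym eq))
    ... | beyond {i'} i<i' with offset i' ℕ.<? L
    ...   | yes off<L = inj₂ (i' , refl , i<i' , off<L , fixed-injective eq)
    τ-fixed () | beyond _ | no _
    τ-fixed () | elsewhere _
    τ-fixed () | inside _

    τ-outside : ∀ {v y} → τ v ≡ fixed y → y ∉ A ∪ B
    τ-outside {v} eq with τ-fixed {v} eq
    ... | inj₁ (_ , refl) = x∉U
    ... | inj₂ (_ , _ , _ , off<L , refl) = nth-All z (outside detour) off<L

    τ-fixed-injective : ∀ {a b y} → τ a ≡ fixed y → τ b ≡ fixed y → a ≡ b
    τ-fixed-injective {a} {b} ea eb with τ-fixed {a} ea | τ-fixed {b} eb
    ... | inj₁ (refl , _) | inj₁ (refl , _) = refl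
    ... | inj₁ (_ , refl) | inj₂ (_ , _ , _ , off<L , along≡x) = ⊥-elim (along≢x off<L along≡x)
    ... | inj₂ (_ , _ , _ , off<L , along≡x) | inj₁ (_ , refl) = ⊥-elim (along≢x off<L along≡x)
    ... | inj₂ (_ , refl , i<i₁ , off₁<L , e₁) | inj₂ (_ , refl , i<i₂ , off₂<L , e₂) =
      cong (λ i' → (c , just (j , i')))
           (offset-injective i<i₁ i<i₂ (nth-injective z (unique detour) off₁<L off₂<L (trans e₁ (sym e₂))))

    embedding : Embedding G (tSttt-Adj t)
    embedding = targetEmbedding code tSttt-code-injective slots′ τ (λ {v} → τ-outside {v}) τ-fixed-injective f-adjacent
      where
      f-adjacent : ∀ {a b} → tSttt-Adj t a b → Edge G (f a) (f b)
      f-adjacent ab with outward-configuration c j i ab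
      ... | inj₁ conf = configuration-edge conf ab
      ... | inj₂ conf = edge-sym G (configuration-edge conf (tSttt-adj-sym ab))

    separates : ¬ Edge G (map embedding s) (map embedding s')
    separates rewrite τ-at | τ-inside s'-inside | insideColour-s' | slot′-s' = ¬xw

  flip-separating : ∀ {V} {Adj : V → V → Set} {a b} → Separating G Adj b a → Separating G Adj a b
  flip-separating (E , ¬ba) = E , ¬ba ∘ edge-sym G

  module _ {t : ℕ} (S : Slots (tSttt-size t)) where

    twistedEmbedding : (Fin t → Bool) → Embedding G (tSttt-Adj t)
    twistedEmbedding flip =
      bipartiteEmbedding tSttt-code tSttt-code-injective S (λ v → parity (depth v) xor flip (proj₁ v))
        (twisted-parity-proper flip)

    separate-by-twist : ∀ a b → proj₁ a ≢ proj₁ b ⊎ parity (depth a) ≡ parity (depth b) →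
      Separating G (tSttt-Adj t) a b
    separate-by-twist a b (inj₂ same) =
      twistedEmbedding (λ _ → false) , same-side-slots-nonadjacent S _ _ (cong (_xor false) same)
    separate-by-twist a b (inj₁ a≢b) = twistedEmbedding flip , same-side-slots-nonadjacent S _ _ same-colour
      where
      flip : Fin t → Bool
      flip c' with c' Fin.≟ proj₁ b
      ... | yes _ = parity (depth a) xor parity (depth b)
      ... | no _ = false
      same-colour : parity (depth a) xor flip (proj₁ a) ≡ parity (depth b) xor flip (proj₁ b)
      same-colour with proj₁ a Fin.≟ proj₁ b | proj₁ b Fin.≟ proj₁ b
      ... | yes a≡b | _ = ⊥-elim (a≢b a≡b)
      ... | no _ | no b≢b = ⊥-elim (b≢b refl)
      ... | no _ | yes _ = begin
        pa xor false       ≡⟨ Bool.xor-identityʳ pa ⟩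
        pa                 ≡⟨ cong (_xor pa) (Bool.xor-same pb) ⟨
        (pb xor pb) xor pa ≡⟨ Bool.xor-assoc pb pb pa ⟩
        pb xor (pb xor pa) ≡⟨ cong (pb xor_) (Bool.xor-comm pb pa) ⟩
        pb xor (pa xor pb) ∎
        where
        open ≡-Reasoning
        pa pb : Bool
        pa = parity (depth a)
        pb = parity (depth b)

    module _ (D : Splitter) where

      separate-along-leg : ∀ c j i {s'} → Inside c j i s' → ¬ tSttt-Adj t s' (c , just (j , i)) →
        parity (depth s') ≢ parity (depth (c , just (j , i))) → Separating G (tSttt-Adj t) (c , just (j , i)) s'
      separate-along-leg c j i s'-inside s'≁s differ = L.embedding , L.separates
        where
        module L = AlongLeg S D c j i s'-inside s'≁s
                     (trans (Bool.¬-not differ) (Bool.not-involutive (parity (toℕ i))))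

      separate-in-spider : ∀ {c} m m' → ¬ tSttt-Adj t (c , m) (c , m') →
        parity (depth (c , m)) ≢ parity (depth (c , m')) → Separating G (tSttt-Adj t) (c , m) (c , m')
      separate-in-spider nothing nothing _ differ = ⊥-elim (differ refl)
      separate-in-spider nothing (just (j , i)) ¬ab differ = flip-separating (separate-along-leg _ j i centre ¬ab differ)
      separate-in-spider (just (j , i)) nothing ¬ab differ =
        separate-along-leg _ j i centre (¬ab ∘ tSttt-adj-sym) (differ ∘ sym)
      separate-in-spider (just (j₁ , i₁)) (just (j₂ , i₂)) ¬ab differ with j₂ Fin.≟ j₁
      ... | no j₂≢j₁ = separate-along-leg _ j₁ i₁ (other-leg j₂≢j₁) (¬ab ∘ tSttt-adj-sym) (differ ∘ sym)
      ... | yes refl with ℕ.<-cmp (toℕ i₁) (toℕ i₂)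
      ...   | tri< i₁<i₂ _ _ = flip-separating (separate-along-leg _ j₂ i₂ (below i₁<i₂) ¬ab differ)
      ...   | tri≈ _ i₁≡i₂ _ = ⊥-elim (differ (cong (parity ∘ suc) i₁≡i₂))
      ...   | tri> _ _ i₂<i₁ = separate-along-leg _ j₂ i₁ (below i₂<i₁) (¬ab ∘ tSttt-adj-sym) (differ ∘ sym)

      separate : ∀ a b → ¬ tSttt-Adj t a b → Separating G (tSttt-Adj t) a b
      separate (c , m) (c' , m') ¬ab with c Fin.≟ c' | parity (depth (c , m)) Bool.≟ parity (depth (c' , m'))
      ... | no c≢c' | _ = separate-by-twist _ _ (inj₁ c≢c')
      ... | yes _ | yes same = separate-by-twist _ _ (inj₂ same)
      ... | yes refl | no differ = separate-in-spider m m' ¬ab differ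

      splitter⇒intersectsTo : IntersectsTo G (tSttt-V t) (tSttt-Adj t)
      splitter⇒intersectsTo =
        intersectsTo-of-separating tSttt-adj? (tSttt-search t) tSttt-code tSttt-code-injective G
          (twistedEmbedding (λ _ → false)) separate

  record SplitSide (x : Fin N) : Set where
    field
      Y   : Bool
      u w : Fin N
      u∈Y : u ∈ side Y
      w∈Y : w ∈ side Y
      xu  : Edge G x u
      ¬xw : ¬ Edge G x w

  module _ (maximal : ∀ A' B' → InducedCompleteBipartite G A' B' →
                        (∀ v → v ∈ A ∪ B → v ∈ A' ∪ B') → ∀ v → v ∈ A' ∪ B' → v ∈ A ∪ B) where

    not-one-sided : ∀ {x} → x ∉ A ∪ B → ∀ b → (∀ v → v ∈ side b → Edge G x v) →
      (∀ v → v ∈ side (not b) → ¬ Edge G x v) → ⊥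
    not-one-sided {x} x∉U true x-A ¬x-B =
      x∉U (maximal A (B ∪ ⁅ x ⁆) (icb-extend {G} x K (x∉U ∘ side⊆U true) x-A ¬x-B) (λ v → ⊆ ∘ inj₁) x (⊆ (inj₂ refl)))
      where
      ⊆ : ∀ {v} → v ∈ A ∪ B ⊎ v ≡ x → v ∈ A ∪ (B ∪ ⁅ x ⁆)
      ⊆ (inj₁ v∈U) = [ x∈p∪q⁺ ∘ inj₁ , x∈p∪q⁺ ∘ inj₂ ∘ x∈p∪q⁺ ∘ inj₁ ]′ (x∈p∪q⁻ A B v∈U)
      ⊆ (inj₂ refl) = x∈p∪q⁺ (inj₂ (x∈p∪q⁺ (inj₂ (x∈⁅x⁆ x))))
    not-one-sided {x} x∉U false x-B ¬x-A =
      x∉U (maximal (A ∪ ⁅ x ⁆) B (icb-swap {G} (icb-extend {G} x (icb-swap {G} K) (x∉U ∘ side⊆U false) x-B ¬x-A))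
                   (λ v → ⊆ ∘ inj₁) x (⊆ (inj₂ refl)))
      where
      ⊆ : ∀ {v} → v ∈ A ∪ B ⊎ v ≡ x → v ∈ (A ∪ ⁅ x ⁆) ∪ B
      ⊆ (inj₁ v∈U) = [ x∈p∪q⁺ ∘ inj₁ ∘ x∈p∪q⁺ ∘ inj₁ , x∈p∪q⁺ ∘ inj₂ ]′ (x∈p∪q⁻ A B v∈U)
      ⊆ (inj₂ refl) = x∈p∪q⁺ (inj₁ (x∈p∪q⁺ (inj₂ (x∈⁅x⁆ x))))

    -- If u₀ and w₀ lie on different sides, maximality provides a second vertex on one of them.
    split-side : ∀ {x u₀ w₀} → x ∉ A ∪ B → u₀ ∈ A ∪ B → w₀ ∈ A ∪ B → Edge G x u₀ → ¬ Edge G x w₀ →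
      SplitSide x
    split-side {x} {u₀} {w₀} x∉U u₀∈U w₀∈U xu₀ ¬xw₀ with U⊆sides u₀∈U | U⊆sides w₀∈U
    ... | b , u₀∈b | b' , w₀∈b' with b Bool.≟ b'
    ...   | yes refl = record { Y = b ; u = u₀ ; w = w₀ ; u∈Y = u₀∈b ; w∈Y = w₀∈b' ; xu = xu₀ ; ¬xw = ¬xw₀ }
    ...   | no b≢b' with Fin.any? (λ v → v ∈? side b ×-dec ¬? (edge? G x v))
    ...     | yes (w , w∈b , ¬xw) = record { Y = b ; u = u₀ ; w = w ; u∈Y = u₀∈b ; w∈Y = w∈b ; xu = xu₀ ; ¬xw = ¬xw }
    ...     | no b-complete with Fin.any? (λ v → v ∈? side b' ×-dec edge? G x v)
    ...       | yes (u , u∈b' , xu) = record { Y = b' ; u = u ; w = w₀ ; u∈Y = u∈b' ; w∈Y = w₀∈b' ; xu = xu ; ¬xw = ¬xw₀ }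
    ...       | no b'-anticomplete = ⊥-elim (not-one-sided x∉U b
                  (λ v v∈b → decidable-stable (edge? G x v) λ ¬xv → b-complete (v , v∈b , ¬xv))
                  (λ v v∈¬b xv → b'-anticomplete (v , subst (λ d → v ∈ side d) ¬b≡b' v∈¬b , xv)))
      where
      ¬b≡b' : not b ≡ b'
      ¬b≡b' = sym (Bool.¬-not (b≢b' ∘ sym))

    module _ {t : ℕ} (inX : InX t G) (noCut : ∀ v → ¬ CutVertex G v)
             (S : Slots (tSttt-size t)) (2<size : 2 < tSttt-size t) where

      no-splitter : Splitter → ⊥
      no-splitter D = inX (splitter⇒intersectsTo S D)

      splitter : ∀ {x} → x ∉ A ∪ B → (P : SplitSide x) → ∀ {z} → z ∈ A ∪ B →
        z ≢ SplitSide.u P → z ≢ SplitSide.w P → Detour (A ∪ B) x z → Splitter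
      splitter {x} x∉U P {z} z∈U z≢u z≢w D = record
        { x = x ; u = u ; w = w ; z = z ; Y = Y ; Z = proj₁ (U⊆sides z∈U)
        ; x∉U = x∉U ; u∈Y = u∈Y ; w∈Y = w∈Y ; z∈Z = proj₂ (U⊆sides z∈U)
        ; xu = xu ; ¬xw = ¬xw ; z≢u = z≢u ; z≢w = z≢w ; detour = D }
        where open SplitSide P

      -- Either x has a second neighbour z in A ∪ B, or a walk from x to w avoiding u (which is not a
      -- cut vertex) yields a detour to some z ≢ u, and w is replaced by a vertex avoiding u and z.
      no-split-side : ∀ {x} → x ∉ A ∪ B → SplitSide x → ⊥
      no-split-side {x} x∉U P@record { Y = Y ; u = u ; w = w ; u∈Y = u∈Y ; w∈Y = w∈Y ; xu = xu ; ¬xw = ¬xw }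
        with Fin.any? (λ v → v ∈? A ∪ B ×-dec ¬? (v Fin.≟ u) ×-dec edge? G x v)
      ... | yes (z , z∈U , z≢u , xz) =
        no-splitter (splitter x∉U P z∈U z≢u (λ { refl → ¬xw xz }) (direct xz))
      ... | no only-u = noCut u (x , w , x≢u , w≢u , no-splitter ∘ walk⇒splitter)
        where
        x≢u : x ≢ u
        x≢u refl = x∉U (side⊆U Y u∈Y)
        w≢u : w ≢ u
        w≢u refl = ¬xw xu
        walk⇒splitter : WalkAvoiding G u x w → Splitter
        walk⇒splitter walk =
          let z , D , z∈U , z≢u = walk⇒detour (A ∪ B) u x∉U walk (side⊆U Y w∈Y)
              p , w'≢u , w'≢z = injective-avoids-two (slot S Y) (slot-injective S Y) 2<size u z
              w' = slot S Y p
              ¬xw' : ¬ Edge G x w'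
              ¬xw' xw' = only-u (w' , side⊆U Y (slot∈side S Y p) , w'≢u , xw')
          in splitter x∉U (record P { w = w' ; w∈Y = slot∈side S Y p ; ¬xw = ¬xw' }) z∈U z≢u (w'≢z ∘ sym) D

      no-splitting-vertex : ∀ {x u₀ w₀} → x ∉ A ∪ B → u₀ ∈ A ∪ B → w₀ ∈ A ∪ B →
        Edge G x u₀ → ¬ Edge G x w₀ → ⊥
      no-splitting-vertex x∉U u₀∈U w₀∈U xu₀ ¬xw₀ = no-split-side x∉U (split-side x∉U u₀∈U w₀∈U xu₀ ¬xw₀)

every-graph-intersects-to-0S : ∀ G → IntersectsTo G (tSttt-V 0) (tSttt-Adj 0)
every-graph-intersects-to-0S G = intersectsTo-of-separating tSttt-adj? (tSttt-search 0) tSttt-code tSttt-code-injective G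
  (record { map = λ { (() , _) } ; injective = λ { {() , _} } ; adjacent = λ { {() , _} } })
  (λ { (() , _) })

theorem4 : (t : ℕ) (G : Graph) → InX t G →
    (∀ x → ¬ CutVertex G x) →
    (A B : Subset (n G)) → MaximalInducedCompleteBipartite G A B →
    3 * (t * t) + t + 1 ≤ ∣ A ∣ → 3 * (t * t) + t + 1 ≤ ∣ B ∣ →
    IsModule G (A ∪ B)
theorem4 zero G inX _ _ _ _ _ _ _ _ = ⊥-elim (inX (every-graph-intersects-to-0S G))
theorem4 t@(suc t') G inX noCut A B (K , maximal) |A|≥ |B|≥ x x∉U with complete⊎anticomplete⊎splits G (A ∪ B) x
... | inj₁ one-sided = one-sided
... | inj₂ ((u₀ , u₀∈U , xu₀) , (w₀ , w₀∈U , ¬xw₀)) =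
  ⊥-elim (no-splitting-vertex maximal inX noCut S (2<tSttt-size t') x∉U u₀∈U w₀∈U xu₀ ¬xw₀)
  where
  open CompleteBipartite G K using (Slots; slots)
  open Splitting G K
  S : Slots (tSttt-size t)
  S = slots (ℕ.≤-trans (tSttt-size-bound t) |A|≥) (ℕ.≤-trans (tSttt-size-bound t) |B|≥)
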